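{- For every $k\ge1$, the number of cyclic permutations of $[2k]$ that are generalized-cycle-up-down (i.e. cyclic permutations whose single cycle is a generalized up-down cycle) is $E_{2k}-(k-1)E_{2k-1}$.
   Context: A cyclic permutation is a permutation with exactly one cycle. A cycle is generalized up-down if it admits some representation $(a_1,a_2,\dots,a_r)$ (i.e. some cyclic rotation of its entries) with $a_1<a_2>a_3<a_4>\cdots$. A permutation is generalized-cycle-up-down if it is a product of generalized up-down cycles. $E_n$ is the Euler number, the number of permutations $\pi_1\cdots\pi_n$ of $[n]$ with $\pi_1<\pi_2>\pi_3<\cdots$. -}

module Defs where

open import Data.Nat using (ℕ; zero; suc; _<_; _>_; _<?_)
open import Data.Nat.Properties using () renaming (_<?_ to _<ℕ?_)
open import Data.Fin using (Fin; toℕ)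
open import Data.Fin.Properties using (any?; all?) renaming (_≟_ to _≟F_)
open import Data.Vec using (Vec; []; _∷_; lookup; toList)
open import Data.List using (List; []; _∷_; length; filter; map; concatMap; iterate; allFin)
open import Data.List.Membership.Propositional using (_∈_)
open import Data.List.Relation.Unary.Unique.Propositional using (Unique)
open import Data.Product using (_×_; ∃)
open import Data.Unit using (⊤; tt)
open import Relation.Nullary using (Dec; yes; no)
open import Relation.Nullary.Decidable using (_×-dec_)

-- A map [n] → [n] in one-line notation: the vector (f 0, f 1, …, f (n-1)).
-- (We use the 0-based ground set Fin n = {0,…,n-1} in place of [n] = {1,…,n};
--  this is order-preserving, so all up/down conditions are unchanged.)
Word : ℕ → Set
Word n = Vec (Fin n) n

allVecs : (m n : ℕ) → List (Vec (Fin n) m)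
allVecs zero    n = [] ∷ []
allVecs (suc m) n = concatMap (λ i → map (i ∷_) (allVecs m n)) (allFin n)

IsPerm : ∀ {n} → Word n → Set
IsPerm v = Unique (toList v)

isPerm? : ∀ {n} (v : Word n) → Dec (IsPerm v)
isPerm? {n} v = unique? (toList v)
  where open import Data.List.Relation.Unary.Unique.DecPropositional (_≟F_ {n}) using (unique?)

mutual
  UpDown : List ℕ → Set
  UpDown []           = ⊤
  UpDown (x ∷ [])     = ⊤
  UpDown (x ∷ y ∷ zs) = x < y × DownUp (y ∷ zs)

  DownUp : List ℕ → Set
  DownUp []           = ⊤
  DownUp (x ∷ [])     = ⊤
  DownUp (x ∷ y ∷ zs) = x > y × UpDown (y ∷ zs)

mutual
  upDown? : (xs : List ℕ) → Dec (UpDown xs)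
  upDown? []           = yes tt
  upDown? (x ∷ [])     = yes tt
  upDown? (x ∷ y ∷ zs) = (x <ℕ? y) ×-dec downUp? (y ∷ zs)

  downUp? : (xs : List ℕ) → Dec (DownUp xs)
  downUp? []           = yes tt
  downUp? (x ∷ [])     = yes tt
  downUp? (x ∷ y ∷ zs) = (y <ℕ? x) ×-dec upDown? (y ∷ zs)

IsAlternating : ∀ {n} → Word n → Set
IsAlternating v = IsPerm v × UpDown (map toℕ (toList v))

isAlternating? : ∀ {n} (v : Word n) → Dec (IsAlternating v)
isAlternating? v = isPerm? v ×-dec upDown? (map toℕ (toList v))

E : ℕ → ℕ
E n = length (filter isAlternating? (allVecs n n))

app : ∀ {n} → Word n → Fin n → Fin n
app v i = lookup v i

-- The list (i, σ i, σ² i, …, σ^{n-1} i).  When σ is a single n-cycle this is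
-- the cycle written starting at i; the n choices of i give all its rotations.
cycleFrom : ∀ {n} → Word n → Fin n → List (Fin n)
cycleFrom {n} v i = iterate (app v) i n

IsCyclic : ∀ {n} → Word n → Set
IsCyclic {n} v = ∀ (i j : Fin n) → j ∈ cycleFrom v i

isCyclic? : ∀ {n} (v : Word n) → Dec (IsCyclic v)
isCyclic? {n} v = all? (λ i → all? (λ j → j ∈? cycleFrom v i))
  where open import Data.List.Membership.DecPropositional (_≟F_ {n}) using (_∈?_)

-- The (single) cycle of σ is generalized up-down: some representation
-- (a₁,…,a_r) (= some rotation, i.e. some starting point) has a₁ < a₂ > a₃ < ⋯
GenUpDownCycle : ∀ {n} → Word n → Set
GenUpDownCycle v = ∃ λ i → UpDown (map toℕ (cycleFrom v i))

genUpDownCycle? : ∀ {n} (v : Word n) → Dec (GenUpDownCycle v)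
genUpDownCycle? v = any? (λ i → upDown? (map toℕ (cycleFrom v i)))

IsCyclicGenUpDown : ∀ {n} → Word n → Set
IsCyclicGenUpDown v = IsPerm v × IsCyclic v × GenUpDownCycle v

isCyclicGenUpDown? : ∀ {n} (v : Word n) → Dec (IsCyclicGenUpDown v)
isCyclicGenUpDown? v = isPerm? v ×-dec (isCyclic? v ×-dec genUpDownCycle? v)

numCyclicGenUpDown : ℕ → ℕ
numCyclicGenUpDown n = length (filter isCyclicGenUpDown? (allVecs n n))

module Submission where

open import Defs
open import Data.Nat using (ℕ; suc; _+_; _*_; _∸_; _≤_)
open import Relation.Binary.PropositionalEquality using (_≡_)
open import Relation.Binary.Definitions using (DecidableEquality)

-- A "good start" of such a σ is a point i from which its cycle reads up-down,
-- (i , σ i , … , σⁿ⁻¹ i) = a₁ < a₂ > ⋯ > aₙ.  We count pairs (σ , i) with i a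
-- good start in two ways.  Reading the cycle from i is a bijection onto the
-- alternating arrangements of [n], so there are E n pairs (`marked-count`).
-- Call σ wide if some good reading also has a₁ < aₙ, i.e. it alternates all
-- the way round the cycle.  Then the good starts are exactly the k entries at
-- even positions of that reading (`wraps-good-starts`); otherwise the good
-- start is unique (`narrow-good-start`).  Finally, wide σ correspond to the
-- alternating arrangements of [m]: read the cycle of σ just after its maximum
-- (`wide-count`).  So #σ = E m + #narrow and E n = k · E m + #narrow.

module Counting where

  open import Data.List using (List; []; _∷_; length; map; _++_; filter)
  open import Data.List.Properties using (length-map; length-++)
  open import Data.List.Membership.Propositional using (_∈_)
  open import Data.List.Membership.Propositional.Properties
    using (∈-map⁺; ∈-map⁻; ∈-++⁺ˡ; ∈-++⁺ʳ; ∈-++⁻; ∈-filter⁺; ∈-filter⁻)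
  open import Data.List.Membership.Propositional.Properties.WithK using (unique∧set⇒bag)
  open import Data.List.Relation.Unary.Any using (here; there)
  open import Data.List.Relation.Unary.All as All using (All; []; _∷_)
  open import Data.List.Relation.Unary.AllPairs using ([]; _∷_)
  open import Data.List.Relation.Unary.Unique.Propositional using (Unique)
  import Data.List.Relation.Unary.Unique.Propositional.Properties as Unique
  open import Data.List.Relation.Binary.BagAndSetEquality using (∼bag⇒↭)
  open import Data.List.Relation.Binary.Permutation.Propositional.Properties using (↭-length)
  open import Data.List.Relation.Binary.Disjoint.Propositional using (Disjoint)
  open import Data.Product using (∃; _×_; _,_; proj₁; proj₂)
  open import Data.Sum using (_⊎_; inj₁; inj₂; [_,_])
  open import Data.Empty using (⊥)
  open import Function.Bundles using (_⇔_; mk⇔)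
  open import Relation.Unary using (Decidable)
  open import Relation.Nullary using (¬_; yes; no)
  open import Relation.Binary.PropositionalEquality using (_≢_; refl; sym; trans; cong; cong₂; subst)

  record Counts {A : Set} (P : A → Set) (m : ℕ) : Set where
    constructor counted
    field
      elems    : List A
      unique   : Unique elems
      size     : length elems ≡ m
      sound    : ∀ {x} → x ∈ elems → P x
      complete : ∀ {x} → P x → x ∈ elems

  -- The number of elements is well defined: two duplicate-free lists with the
  -- same members are permutations of each other.
  counts-unique : ∀ {A : Set} {P : A → Set} {m m′} → Counts P m → Counts P m′ → m ≡ m′
  counts-unique (counted xs u l s c) (counted ys u′ l′ s′ c′) =
    trans (sym l) (trans (↭-length (∼bag⇒↭ (unique∧set⇒bag u u′ same-members))) l′)
    where
    same-members : ∀ {z} → (z ∈ xs) ⇔ (z ∈ ys)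
    same-members = mk⇔ (λ p → c′ (s p)) (λ p → c (s′ p))

  counts-⇔ : ∀ {A : Set} {P Q : A → Set} {m} →
    (∀ {x} → P x → Q x) → (∀ {x} → Q x → P x) → Counts P m → Counts Q m
  counts-⇔ f g (counted xs u l s c) = counted xs u l (λ p → f (s p)) (λ q → c (g q))

  counts-filter : ∀ {A : Set} {P : A → Set} (P? : Decidable P) (all : List A) →
    Unique all → (∀ x → x ∈ all) → Counts P (length (filter P? all))
  counts-filter P? all u c =
    counted (filter P? all) (Unique.filter⁺ P? u) refl
      (λ p → proj₂ (∈-filter⁻ P? {xs = all} p)) (λ p → ∈-filter⁺ P? (c _) p)

  map-unique : ∀ {A B : Set} (f : A → B) (xs : List A) →
    (∀ {x y} → x ∈ xs → y ∈ xs → f x ≡ f y → x ≡ y) → Unique xs → Unique (map f xs)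
  map-unique f [] inj [] = []
  map-unique f (x ∷ xs) inj (x∉xs ∷ u) =
    images-differ xs x∉xs (λ p → p) ∷ map-unique f xs (λ p q → inj (there p) (there q)) u
    where
    images-differ : ∀ ys → All (x ≢_) ys → (∀ {y} → y ∈ ys → y ∈ xs) → All (f x ≢_) (map f ys)
    images-differ [] [] _ = []
    images-differ (y ∷ ys) (x≢y ∷ x≢ys) sub =
      (λ e → x≢y (inj (here refl) (there (sub (here refl))) e)) ∷ images-differ ys x≢ys (λ p → sub (there p))

  counts-bij : ∀ {A B : Set} {P : A → Set} {Q : B → Set} {m} (f : A → B) →
    (∀ {x y} → P x → P y → f x ≡ f y → x ≡ y) →
    (∀ {x} → P x → Q (f x)) →
    (∀ {y} → Q y → ∃ λ x → P x × f x ≡ y) →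
    Counts P m → Counts Q m
  counts-bij {Q = Q} f inj pres surj (counted xs u l s c) =
    counted (map f xs) (map-unique f xs (λ p q → inj (s p) (s q)) u) (trans (length-map f xs) l)
      (λ p → let (x , x∈ , e) = ∈-map⁻ f p in subst Q (sym e) (pres (s x∈)))
      (λ q → let (x , px , e) = surj q in subst (_∈ map f xs) e (∈-map⁺ f (c px)))

  counts-⊎ : ∀ {A : Set} {P Q : A → Set} {m n} → (∀ {x} → P x → Q x → ⊥) →
    Counts P m → Counts Q n → Counts (λ x → P x ⊎ Q x) (m + n)
  counts-⊎ disjoint (counted xs u l s c) (counted ys u′ l′ s′ c′) =
    counted (xs ++ ys) (Unique.++⁺ u u′ (λ (p , q) → disjoint (s p) (s′ q)))
      (trans (length-++ xs) (cong₂ _+_ l l′))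
      (λ p → [ (λ q → inj₁ (s q)) , (λ q → inj₂ (s′ q)) ] (∈-++⁻ xs p))
      (λ { (inj₁ p) → ∈-++⁺ˡ (c p) ; (inj₂ q) → ∈-++⁺ʳ xs (c′ q) })

  counts-split : ∀ {A : Set} {P Q : A → Set} {a b} → Decidable Q →
    Counts (λ x → P x × Q x) a → Counts (λ x → P x × ¬ Q x) b → Counts P (a + b)
  counts-split {P = P} {Q} Q? with-Q without-Q =
    counts-⇔ [ proj₁ , proj₁ ] split (counts-⊎ (λ (_ , q) (_ , ¬q) → ¬q q) with-Q without-Q)
    where
    split : ∀ {x} → P x → (P x × Q x) ⊎ (P x × ¬ Q x)
    split {x} px with Q? x
    ... | yes q = inj₁ (px , q)
    ... | no ¬q = inj₂ (px , ¬q)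

  counts-single : ∀ {A : Set} {P : A → Set} (a : A) → P a → (∀ {x} → P x → x ≡ a) → Counts P 1
  counts-single a pa unique-a =
    counted (a ∷ []) ([] ∷ []) refl (λ { (here refl) → pa }) (λ p → here (unique-a p))

  module _ {A B : Set} {C : A → Set} {Q : A → B → Set} {k : ℕ}
           (fibre : ∀ {a} → C a → Counts (Q a) k) where

    fibreList : ∀ {a} → C a → List (A × B)
    fibreList {a} c = map (a ,_) (Counts.elems (fibre c))

    fibreList-sound : ∀ {a} (c : C a) {p} → p ∈ fibreList c → proj₁ p ≡ a × Q a (proj₂ p)
    fibreList-sound {a} c p∈ with ∈-map⁻ (a ,_) p∈
    ... | b , b∈ , refl = refl , Counts.sound (fibre c) b∈

    pairsOver : (xs : List A) → All C xs → List (A × B)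
    pairsOver [] [] = []
    pairsOver (x ∷ xs) (c ∷ cs) = fibreList c ++ pairsOver xs cs

    pairsOver-sound : ∀ xs cs {p} → p ∈ pairsOver xs cs → proj₁ p ∈ xs × Q (proj₁ p) (proj₂ p)
    pairsOver-sound (x ∷ xs) (c ∷ cs) p∈ with ∈-++⁻ (fibreList c) p∈
    ... | inj₂ q = let (a , b) = pairsOver-sound xs cs q in there a , b
    ... | inj₁ q with fibreList-sound c q
    ...   | refl , qb = here refl , qb

    pairsOver-complete : ∀ xs cs {a b} → a ∈ xs → Q a b → (a , b) ∈ pairsOver xs cs
    pairsOver-complete (x ∷ xs) (c ∷ cs) (here refl) q =
      ∈-++⁺ˡ (∈-map⁺ (x ,_) (Counts.complete (fibre c) q))
    pairsOver-complete (x ∷ xs) (c ∷ cs) (there a∈) q =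
      ∈-++⁺ʳ (fibreList c) (pairsOver-complete xs cs a∈ q)

    pairsOver-length : ∀ xs cs → length (pairsOver xs cs) ≡ length xs * k
    pairsOver-length [] [] = refl
    pairsOver-length (x ∷ xs) (c ∷ cs) =
      trans (length-++ (fibreList c))
            (cong₂ _+_ (trans (length-map _ (Counts.elems (fibre c))) (Counts.size (fibre c)))
                       (pairsOver-length xs cs))

    pairsOver-unique : ∀ xs cs → Unique xs → Unique (pairsOver xs cs)
    pairsOver-unique [] [] u = []
    pairsOver-unique (x ∷ xs) (c ∷ cs) (x∉xs ∷ u) =
      Unique.++⁺ (map-unique (x ,_) _ (λ _ _ e → cong proj₂ e) (Counts.unique (fibre c)))
                 (pairsOver-unique xs cs u) disjoint
      where
      disjoint : Disjoint (fibreList c) (pairsOver xs cs)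
      disjoint (p₁ , p₂) with fibreList-sound c p₁ | pairsOver-sound xs cs p₂
      ... | refl , _ | x∈xs , _ = All.lookup x∉xs x∈xs refl

    counts-Σ : ∀ {m} → Counts C m → Counts (λ (p : A × B) → C (proj₁ p) × Q (proj₁ p) (proj₂ p)) (m * k)
    counts-Σ (counted xs u l s c) =
      counted (pairsOver xs cs) (pairsOver-unique xs cs u) (trans (pairsOver-length xs cs) (cong (_* k) l))
        (λ p → let (a , q) = pairsOver-sound xs cs p in s a , q)
        (λ (ca , q) → pairsOver-complete xs cs (c ca) q)
      where cs = All.tabulate s

module Enumeration where

  open Counting
  open import Data.Nat using (zero)
  open import Data.Fin using (Fin)
  open import Data.Vec using (Vec; []; _∷_; head)
  open import Data.Vec.Properties using (∷-injective)
  open import Data.List using (List; []; _∷_; map; concatMap; filter; length; allFin)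
  open import Data.List.Membership.Propositional using (_∈_)
  open import Data.List.Membership.Propositional.Properties
    using (∈-map⁺; ∈-map⁻; ∈-concat⁺′; ∈-concat⁻′; ∈-allFin)
  open import Data.List.Relation.Unary.Any using (here)
  open import Data.List.Relation.Unary.All as All using ([]; _∷_)
  open import Data.List.Relation.Unary.AllPairs using ([]; _∷_)
  open import Data.List.Relation.Unary.Unique.Propositional using (Unique)
  import Data.List.Relation.Unary.Unique.Propositional.Properties as Unique
  open import Data.List.Relation.Binary.Disjoint.Propositional using (Disjoint)
  open import Data.Product using (_,_; proj₂)
  open import Relation.Unary using (Decidable)
  open import Relation.Binary.PropositionalEquality using (refl; sym; trans)

  allVecs-complete : ∀ m n (v : Vec (Fin n) m) → v ∈ allVecs m n
  allVecs-complete zero n [] = here refl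
  allVecs-complete (suc m) n (i ∷ v) =
    ∈-concat⁺′ (∈-map⁺ (i ∷_) (allVecs-complete m n v))
               (∈-map⁺ (λ j → map (j ∷_) (allVecs m n)) (∈-allFin i))

  allVecs-unique : ∀ m n → Unique (allVecs m n)
  allVecs-unique zero n = [] ∷ []
  allVecs-unique (suc m) n = blocks-unique (allFin n) (Unique.allFin⁺ n)
    where
    block : Fin n → List (Vec (Fin n) (suc m))
    block j = map (j ∷_) (allVecs m n)

    block-head : ∀ {j v} → v ∈ block j → head v ≡ j
    block-head {j} p with ∈-map⁻ (j ∷_) p
    ... | _ , _ , refl = refl

    blocks-unique : (is : List (Fin n)) → Unique is → Unique (concatMap block is)
    blocks-unique [] [] = []
    blocks-unique (i ∷ is) (i∉is ∷ u) =
      Unique.++⁺ (map-unique (i ∷_) _ (λ _ _ e → proj₂ (∷-injective e)) (allVecs-unique m n))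
                 (blocks-unique is u) disjoint
      where
      disjoint : Disjoint (block i) (concatMap block is)
      disjoint (p , q) with ∈-concat⁻′ (map block is) q
      ... | _ , v∈b , b∈ with ∈-map⁻ block b∈
      ... | j , j∈ , refl = All.lookup i∉is j∈ (trans (sym (block-head p)) (block-head v∈b))

  counts-words : ∀ {n} {P : Word n → Set} (P? : Decidable P) →
    Counts P (length (filter P? (allVecs n n)))
  counts-words {n} P? = counts-filter P? (allVecs n n) (allVecs-unique n n) (allVecs-complete n n)

module DuplicateFree {X : Set} where

  open import Data.Nat using (z≤n; s≤s)
  open import Data.Nat.Properties using (≤-pred; ≤⇒≯)
  open import Data.List using (List; []; _∷_; _++_; length)
  open import Data.List.Properties using (length-++-sucʳ)
  open import Data.List.Membership.Propositional using (_∈_; _∉_)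
  open import Data.List.Membership.Propositional.Properties using (∈-∃++; ∈-insert)
  open import Data.List.Relation.Unary.Any using (here; there)
  open import Data.List.Relation.Unary.All as All using ([]; _∷_)
  import Data.List.Relation.Unary.All.Properties as All
  open import Data.List.Relation.Unary.AllPairs using ([]; _∷_)
  open import Data.List.Relation.Unary.Unique.Propositional using (Unique)
  open import Data.Product using (_,_)
  open import Data.Empty using (⊥-elim)
  open import Relation.Nullary using (yes; no)
  open import Relation.Binary.PropositionalEquality using (_≢_; refl; sym; subst)

  ∈-remove : ∀ {z y : X} p q → z ∈ p ++ y ∷ q → z ≢ y → z ∈ p ++ q
  ∈-remove [] q (here z≡y) z≢y = ⊥-elim (z≢y z≡y)
  ∈-remove [] q (there z∈q) z≢y = z∈q
  ∈-remove (x ∷ p) q (here z≡x) z≢y = here z≡x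
  ∈-remove (x ∷ p) q (there z∈) z≢y = there (∈-remove p q z∈ z≢y)

  ∈-insert-between : ∀ {z} p (y : X) q → z ∈ p ++ q → z ∈ p ++ y ∷ q
  ∈-insert-between [] y q z∈ = there z∈
  ∈-insert-between (x ∷ p) y q (here z≡x) = here z≡x
  ∈-insert-between (x ∷ p) y q (there z∈) = there (∈-insert-between p y q z∈)

  unique-remove : ∀ (p : List X) y q → Unique (p ++ y ∷ q) → Unique (p ++ q)
  unique-remove [] y q (_ ∷ u) = u
  unique-remove (x ∷ p) y q (x∉ ∷ u) =
    All.tabulate (λ z∈ → All.lookup x∉ (∈-insert-between p y q z∈)) ∷ unique-remove p y q u

  unique-notin : ∀ (p : List X) y q → Unique (p ++ y ∷ q) → y ∉ p ++ q
  unique-notin [] y q (y∉q ∷ _) y∈ = All.lookup y∉q y∈ refl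
  unique-notin (x ∷ p) y q (x∉ ∷ u) (here refl) = All.lookup x∉ (∈-insert p) refl
  unique-notin (x ∷ p) y q (x∉ ∷ u) (there y∈) = unique-notin p y q u y∈

  length-⊆ : ∀ (ys xs : List X) → Unique ys → (∀ {x} → x ∈ ys → x ∈ xs) → length ys ≤ length xs
  length-⊆ [] xs u sub = z≤n
  length-⊆ (y ∷ ys) xs (y∉ys ∷ u) sub with ∈-∃++ (sub (here refl))
  ... | p , q , refl =
    subst (suc (length ys) ≤_) (sym (length-++-sucʳ p y q))
      (s≤s (length-⊆ ys (p ++ q) u
        (λ x∈ → ∈-remove p q (sub (there x∈)) (λ x≡y → All.lookup y∉ys x∈ (sym x≡y)))))

  drop-head-cover : ∀ {y : X} {t S : List X} → (∀ {x} → x ∈ S → x ∈ y ∷ t) → (y ∈ S → y ∈ t) →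
    ∀ {x} → x ∈ S → x ∈ t
  drop-head-cover cov redundant x∈ with cov x∈
  ... | here refl = redundant x∈
  ... | there x∈t = x∈t

  module _ (_≟_ : DecidableEquality X) where
    open import Data.List.Membership.DecPropositional _≟_ using (_∈?_)

    covering-unique : ∀ (xs S : List X) → Unique S → (∀ {x} → x ∈ S → x ∈ xs) →
      length xs ≤ length S → Unique xs
    covering-unique [] S uS cov le = []
    covering-unique (y ∷ t) S uS cov le with y ∈? t | y ∈? S
    ... | yes y∈t | _ = ⊥-elim (≤⇒≯ (length-⊆ S t uS (drop-head-cover cov (λ _ → y∈t))) le)
    ... | no _ | no y∉S =
      ⊥-elim (≤⇒≯ (length-⊆ S t uS (drop-head-cover cov (λ y∈S → ⊥-elim (y∉S y∈S)))) le)
    ... | no y∉t | yes y∈S with ∈-∃++ y∈S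
    ...   | p , q , refl =
      All.¬Any⇒All¬ t y∉t ∷ covering-unique t (p ++ q) (unique-remove p y q uS) t-covers
        (≤-pred (subst (suc (length t) ≤_) (length-++-sucʳ p y q) le))
      where
      t-covers : ∀ {x} → x ∈ p ++ q → x ∈ t
      t-covers x∈ with cov (∈-insert-between p y q x∈)
      ... | here refl = ⊥-elim (unique-notin p y q uS x∈)
      ... | there x∈t = x∈t

    unique-covering : ∀ (w S : List X) → Unique w → (∀ {x} → x ∈ w → x ∈ S) →
      length S ≤ length w → ∀ {x} → x ∈ S → x ∈ w
    unique-covering w S uw sub le {x} x∈S with x ∈? w
    ... | yes x∈w = x∈w
    ... | no x∉w = ⊥-elim (≤⇒≯ le (length-⊆ (x ∷ w) S (All.¬Any⇒All¬ w x∉w ∷ uw)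
                                     (λ { (here refl) → x∈S ; (there x∈) → sub x∈ })))

module Chains {X : Set} where

  open import Data.Nat using (zero)
  open import Data.List using (List; []; _∷_; _++_; [_]; length; iterate; map)
  open import Data.List.Properties using (++-assoc; ++-identityʳ; ∷-injectiveʳ)
  open import Data.List.Membership.Propositional using (_∈_)
  open import Data.List.Relation.Unary.Any using (here; there)
  open import Data.List.Relation.Unary.Unique.Propositional using (Unique)
  import Data.List.Relation.Unary.Unique.Propositional.Properties as Unique
  open import Data.Product using (_×_; _,_; proj₁; proj₂; ∃)
  open import Data.Unit using (⊤; tt)
  open import Data.Empty using (⊥-elim)
  open import Relation.Binary.PropositionalEquality using (refl; sym; trans; cong; subst)
  open DuplicateFree {X} using (unique-notin)

  Chain : (X → X) → List X → Set
  Chain f [] = ⊤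
  Chain f (x ∷ []) = ⊤
  Chain f (x ∷ y ∷ t) = f x ≡ y × Chain f (y ∷ t)

  Closed : (X → X) → List X → Set
  Closed f [] = ⊤
  Closed f (h ∷ r) = Chain f ((h ∷ r) ++ [ h ])

  module _ {f : X → X} where

    chain-split : ∀ p x q → Chain f (p ++ x ∷ q) → Chain f (p ++ [ x ]) × Chain f (x ∷ q)
    chain-split [] x q c = tt , c
    chain-split (y ∷ []) x q (e , c) = (e , tt) , c
    chain-split (y ∷ z ∷ p) x q (e , c) = let (c₁ , c₂) = chain-split (z ∷ p) x q c in (e , c₁) , c₂

    chain-join : ∀ p x q → Chain f (p ++ [ x ]) → Chain f (x ∷ q) → Chain f (p ++ x ∷ q)
    chain-join [] x q c₁ c₂ = c₂
    chain-join (y ∷ []) x q (e , _) c₂ = e , c₂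
    chain-join (y ∷ z ∷ p) x q (e , c₁) c₂ = e , chain-join (z ∷ p) x q c₁ c₂

    chain-step : ∀ p x y q → Chain f (p ++ x ∷ y ∷ q) → f x ≡ y
    chain-step p x y q c = proj₁ (proj₂ (chain-split p x (y ∷ q) c))

    chain-prefix : ∀ p q → Chain f (p ++ q) → Chain f p
    chain-prefix [] q c = tt
    chain-prefix (x ∷ []) q c = tt
    chain-prefix (x ∷ y ∷ p) q (e , c) = e , chain-prefix (y ∷ p) q c

    chain-image : ∀ h l → Chain f (h ∷ l) → ∀ {z} → z ∈ l → ∃ λ u → f u ≡ z
    chain-image h (y ∷ l) (e , c) (here refl) = h , e
    chain-image h (y ∷ l) (e , c) (there z∈) = chain-image y l c z∈

    chain-iterate : ∀ x r → Chain f (x ∷ r) → iterate f x (suc (length r)) ≡ x ∷ r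
    chain-iterate x [] c = refl
    chain-iterate x (y ∷ r) (refl , c) = cong (x ∷_) (chain-iterate (f x) r c)

    iterate-chain : ∀ x n → Chain f (iterate f x n)
    iterate-chain x zero = tt
    iterate-chain x (suc zero) = tt
    iterate-chain x (suc (suc n)) = refl , iterate-chain (f x) (suc n)

    iterate-map : ∀ n x → iterate f (f x) n ≡ map f (iterate f x n)
    iterate-map zero x = refl
    iterate-map (suc n) x = cong (f x ∷_) (iterate-map n (f x))

    iterate-snoc : ∀ n x → ∃ λ y → iterate f x (suc n) ≡ iterate f x n ++ [ y ]
    iterate-snoc zero x = x , refl
    iterate-snoc (suc n) x = let (y , e) = iterate-snoc n (f x) in y , cong (x ∷_) e

    closed-rotate : ∀ p q → Closed f (p ++ q) → Closed f (q ++ p)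
    closed-rotate [] q c = subst (Closed f) (sym (++-identityʳ q)) c
    closed-rotate (h ∷ p) [] c = subst (Closed f) (++-identityʳ (h ∷ p)) c
    closed-rotate (h ∷ p) (z ∷ q) c =
      let (c₁ , c₂) = chain-split (h ∷ p) z (q ++ [ h ])
                        (subst (Chain f) (cong (h ∷_) (++-assoc p (z ∷ q) [ h ])) c)
      in subst (Chain f) (cong (z ∷_) (sym (++-assoc q (h ∷ p) [ z ])))
               (chain-join (z ∷ q) h (p ++ [ z ]) c₂ c₁)

    closed-iterate : ∀ x r → Closed f (x ∷ r) → iterate f x (suc (length r)) ≡ x ∷ r
    closed-iterate x r c = chain-iterate x r (chain-prefix (x ∷ r) [ x ] c)

    -- For injective f, an orbit without repetition that contains every point
    -- closes up into a cycle: the next iterate is the start again, since any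
    -- other entry is already the image of an earlier one.
    orbit-closed : (∀ {a b} → f a ≡ f b → a ≡ b) → ∀ m i →
      Unique (iterate f i (suc m)) → (∀ j → j ∈ iterate f i (suc m)) →
      Closed f (iterate f i (suc m))
    orbit-closed inj m i u covers with iterate-snoc (suc m) i
    ... | y , ext with covers y
    ... | here refl = subst (Chain f) ext (iterate-chain i (suc (suc m)))
    ... | there y∈rest = ⊥-elim (unique-notin rest y [] (subst Unique images≡ images-unique)
                                     (subst (y ∈_) (sym (++-identityʳ rest)) y∈rest))
      where
      rest = iterate f (f i) m
      images≡ : map f (iterate f i (suc m)) ≡ rest ++ [ y ]
      images≡ = trans (sym (iterate-map (suc m) i)) (∷-injectiveʳ ext)
      images-unique : Unique (map f (iterate f i (suc m)))
      images-unique = Unique.map⁺ inj u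

  chain-cong : ∀ {f g : X → X} → (∀ x → f x ≡ g x) → ∀ l → Chain f l → Chain g l
  chain-cong f≗g [] c = tt
  chain-cong f≗g (x ∷ []) c = tt
  chain-cong f≗g (x ∷ y ∷ l) (e , c) = trans (sym (f≗g x)) e , chain-cong f≗g (y ∷ l) c

-- The cyclic successor in a duplicate-free list: `after h w x` is the entry
-- following x in w, or h when x is the last entry.  For w = h ∷ r this is the
-- permutation whose single cycle is w.
module Successor {X : Set} (_≟_ : DecidableEquality X) where

  open import Data.List using (List; []; _∷_; _++_; [_])
  open import Data.List.Properties using (++-assoc)
  open import Data.List.Membership.Propositional using (_∈_)
  open import Data.List.Membership.Propositional.Properties using (∈-∃++; ∈-insert)
  open import Data.List.Relation.Unary.Any using (here)
  open import Data.List.Relation.Unary.All as All using (_∷_)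
  open import Data.List.Relation.Unary.AllPairs using (_∷_)
  open import Data.List.Relation.Unary.Unique.Propositional using (Unique)
  open import Data.Product using (_,_)
  open import Data.Unit using (tt)
  open import Data.Empty using (⊥-elim)
  open import Data.Bool using (if_then_else_)
  open import Relation.Nullary using (does; yes; no)
  open import Relation.Binary.PropositionalEquality using (refl; sym; trans; cong; subst; module ≡-Reasoning)
  open Chains {X}
  open ≡-Reasoning

  after : X → List X → X → X
  after h [] x = x
  after h (y ∷ []) x = h
  after h (y ∷ z ∷ t) x = if does (x ≟ y) then z else after h (z ∷ t) x

  after-inner : ∀ h p x z q → Unique (p ++ x ∷ z ∷ q) → after h (p ++ x ∷ z ∷ q) x ≡ z
  after-inner h [] x z q u with x ≟ x
  ... | yes _ = refl
  ... | no x≢x = ⊥-elim (x≢x refl)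
  after-inner h (y ∷ []) x z q (y∉ ∷ u) with x ≟ y
  ... | yes refl = ⊥-elim (All.lookup y∉ (here refl) refl)
  ... | no _ = after-inner h [] x z q u
  after-inner h (y ∷ y′ ∷ p) x z q (y∉ ∷ u) with x ≟ y
  ... | yes refl = ⊥-elim (All.lookup y∉ (∈-insert (y′ ∷ p)) refl)
  ... | no _ = after-inner h (y′ ∷ p) x z q u

  after-last : ∀ h p x → Unique (p ++ [ x ]) → after h (p ++ [ x ]) x ≡ h
  after-last h [] x u = refl
  after-last h (y ∷ []) x (y∉ ∷ u) with x ≟ y
  ... | yes refl = ⊥-elim (All.lookup y∉ (here refl) refl)
  ... | no _ = refl
  after-last h (y ∷ y′ ∷ p) x (y∉ ∷ u) with x ≟ y
  ... | yes refl = ⊥-elim (All.lookup y∉ (∈-insert (y′ ∷ p)) refl)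
  ... | no _ = after-last h (y′ ∷ p) x u

  after-chain : ∀ h w → Unique w → Chain (after h w) (w ++ [ h ])
  after-chain h w u = go [] w refl
    where
    go : ∀ p q → w ≡ p ++ q → Chain (after h w) (q ++ [ h ])
    go p [] e = tt
    go p (x ∷ []) refl = after-last h p x u , tt
    go p (x ∷ z ∷ q) refl =
      after-inner h p x z q u , go (p ++ [ x ]) (z ∷ q) (sym (++-assoc p [ x ] (z ∷ q)))

  after-closed : ∀ (f : X → X) h r x → Unique (h ∷ r) → Closed f (h ∷ r) → x ∈ h ∷ r →
    after h (h ∷ r) x ≡ f x
  after-closed f h r x u c x∈ with ∈-∃++ x∈
  ... | p , [] , e = begin
    after h (h ∷ r) x       ≡⟨ cong (λ w → after h w x) e ⟩
    after h (p ++ [ x ]) x  ≡⟨ after-last h p x (subst Unique e u) ⟩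
    h                       ≡⟨ sym (chain-step p x h [] (subst (Chain f) (closing e) c)) ⟩
    f x                     ∎
    where
    closing : h ∷ r ≡ p ++ [ x ] → (h ∷ r) ++ [ h ] ≡ p ++ x ∷ h ∷ []
    closing e = trans (cong (_++ [ h ]) e) (++-assoc p [ x ] [ h ])
  ... | p , z ∷ q , e = begin
    after h (h ∷ r) x            ≡⟨ cong (λ w → after h w x) e ⟩
    after h (p ++ x ∷ z ∷ q) x   ≡⟨ after-inner h p x z q (subst Unique e u) ⟩
    z                            ≡⟨ sym (chain-step p x z (q ++ [ h ]) (subst (Chain f) (closing e) c)) ⟩
    f x                          ∎
    where
    closing : h ∷ r ≡ p ++ x ∷ z ∷ q → (h ∷ r) ++ [ h ] ≡ p ++ x ∷ z ∷ q ++ [ h ]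
    closing e = trans (cong (_++ [ h ]) e) (++-assoc p (x ∷ z ∷ q) [ h ])

-- Alternating sequences of naturals.  `Alt true` is "up-down" (a₁ < a₂ > ⋯) and
-- `Alt false` is "down-up"; reading past an entry flips the direction, so the
-- parity of a prefix decides which kind its remainder is.
module Alternating where

  open import Data.Bool using (Bool; true; false; not)
  open import Data.Bool.Properties using (not-injective)
  open import Data.Nat using (zero; pred; _<_)
  open import Data.Nat.Properties using (<-asym; ≤⇒≯; _<?_)
  open import Data.List using (List; []; _∷_; _++_; [_]; length; map)
  open import Data.List.Properties using (++-assoc; ++-identityʳ)
  open import Data.List.Relation.Unary.All as All using (All; []; _∷_)
  import Data.List.Relation.Unary.All.Properties as All
  open import Data.Product using (_,_; ∃)
  open import Data.Unit using (tt)
  open import Data.Empty using (⊥; ⊥-elim)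
  open import Relation.Nullary using (¬_; Dec; no)
  open import Relation.Binary.PropositionalEquality using (refl; sym; trans; cong; subst)

  Alt : Bool → List ℕ → Set
  Alt true = UpDown
  Alt false = DownUp

  flips : ∀ {A : Set} → List A → Bool → Bool
  flips [] b = b
  flips (x ∷ xs) b = flips xs (not b)

  Even Odd : ∀ {A : Set} → List A → Set
  Even p = flips p true ≡ true
  Odd p = flips p true ≡ false

  flips-++ : ∀ {A : Set} (p q : List A) b → flips (p ++ q) b ≡ flips q (flips p b)
  flips-++ [] q b = refl
  flips-++ (x ∷ p) q b = flips-++ p q (not b)

  flips-map : ∀ {A B : Set} (f : A → B) p b → flips (map f p) b ≡ flips p b
  flips-map f [] b = refl
  flips-map f (x ∷ p) b = flips-map f p (not b)

  even-++ : ∀ {A : Set} (p q : List A) → Even p → flips (p ++ q) true ≡ flips q true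
  even-++ p q ep = trans (flips-++ p q true) (cong (flips q) ep)

  flips-snoc : ∀ {A : Set} (p : List A) x b → flips (p ++ [ x ]) b ≡ not (flips p b)
  flips-snoc p x b = flips-++ p [ x ] b

  even-double : ∀ {A : Set} k (p : List A) → length p ≡ k * 2 → Even p
  even-double zero [] e = refl
  even-double (suc k) (x ∷ y ∷ p) e = even-double k p (cong (λ n → pred (pred n)) e)

  odd-middle : ∀ {A : Set} (p zs : List A) ℓ → Even (p ++ zs ++ [ ℓ ]) → Even p → Odd zs
  odd-middle p zs ℓ eq ep =
    not-injective (trans (sym (flips-snoc zs ℓ true)) (trans (sym (even-++ p (zs ++ [ ℓ ]) ep)) eq))

  lastOr : ∀ {A : Set} → A → List A → A
  lastOr d [] = d
  lastOr d (x ∷ t) = lastOr x t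

  lastOr-++ : ∀ {A : Set} (d : A) p y q → lastOr d (p ++ y ∷ q) ≡ lastOr y q
  lastOr-++ d [] y q = refl
  lastOr-++ d (x ∷ p) y q = lastOr-++ x p y q

  snoc-view : ∀ {A : Set} (y : A) q → ∃ λ zs → y ∷ q ≡ zs ++ [ lastOr y q ]
  snoc-view y [] = [] , refl
  snoc-view y (z ∷ q) = let (zs , e) = snoc-view z q in y ∷ zs , cong (y ∷_) e

  WrapsUp : List ℕ → Set
  WrapsUp [] = ⊥
  WrapsUp (x ∷ t) = x < lastOr x t

  wrapsUp? : ∀ a → Dec (WrapsUp a)
  wrapsUp? [] = no (λ ())
  wrapsUp? (x ∷ t) = x <? lastOr x t

  alt-tail : ∀ b x t → Alt b (x ∷ t) → Alt (not b) t
  alt-tail true x [] _ = tt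
  alt-tail false x [] _ = tt
  alt-tail true x (y ∷ t) (_ , a) = a
  alt-tail false x (y ∷ t) (_ , a) = a

  alt-first : ∀ b x y t → Alt b (x ∷ y ∷ t) → Alt b (x ∷ y ∷ [])
  alt-first true x y t (r , _) = r , tt
  alt-first false x y t (r , _) = r , tt

  alt-cons : ∀ b x y t → Alt b (x ∷ y ∷ []) → Alt (not b) (y ∷ t) → Alt b (x ∷ y ∷ t)
  alt-cons true x y t (r , _) a = r , a
  alt-cons false x y t (r , _) a = r , a

  alt-single : ∀ b x → Alt b (x ∷ [])
  alt-single true x = tt
  alt-single false x = tt

  alt-empty : ∀ b → Alt b []
  alt-empty true = tt
  alt-empty false = tt

  alt-prefix : ∀ b p q → Alt b (p ++ q) → Alt b p
  alt-prefix b [] q a = alt-empty b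
  alt-prefix b (x ∷ []) q a = alt-single b x
  alt-prefix b (x ∷ y ∷ p) q a =
    alt-cons b x y p (alt-first b x y _ a) (alt-prefix (not b) (y ∷ p) q (alt-tail b x _ a))

  alt-suffix : ∀ b p q → Alt b (p ++ q) → Alt (flips p b) q
  alt-suffix b [] q a = a
  alt-suffix b (x ∷ p) q a = alt-suffix (not b) p q (alt-tail b x (p ++ q) a)

  alt-join : ∀ b p x q → Alt b (p ++ [ x ]) → Alt (flips p b) (x ∷ q) → Alt b (p ++ x ∷ q)
  alt-join b [] x q a₁ a₂ = a₂
  alt-join b (y ∷ []) x q a₁ a₂ = alt-cons b y x q a₁ a₂
  alt-join b (y ∷ z ∷ p) x q a₁ a₂ =
    alt-cons b y z (p ++ x ∷ q) (alt-first b y z _ a₁) (alt-join (not b) (z ∷ p) x q (alt-tail b y _ a₁) a₂)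

  -- Positions are counted from 0.  Starting an up-down list at an entry of
  -- odd position never gives an up-down list.
  odd-rotation-not-upDown : ∀ p y q → UpDown (p ++ y ∷ q) → Odd p → ¬ UpDown (y ∷ q ++ p)
  odd-rotation-not-upDown p y q a op r with subst (λ b → Alt b (y ∷ q)) op (alt-suffix true p (y ∷ q) a)
  odd-rotation-not-upDown p y (y′ ∷ q) a op (y<y′ , _) | (y>y′ , _) = <-asym y<y′ y>y′
  odd-rotation-not-upDown [] y [] a () r | _
  odd-rotation-not-upDown (x₀ ∷ []) y [] (x₀<y , _) op (y<x₀ , _) | _ = <-asym x₀<y y<x₀
  odd-rotation-not-upDown (x₀ ∷ x₁ ∷ p) y [] (x₀<x₁ , _) op (_ , x₀>x₁ , _) | _ = <-asym x₀<x₁ x₀>x₁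

  -- An even-length up-down list that wraps up (aₙ > a₁) is "cyclically
  -- alternating", so it stays up-down when started at any even position.
  even-rotation-upDown : ∀ p q → Even (p ++ q) → UpDown (p ++ q) → WrapsUp (p ++ q) → Even p →
    UpDown (q ++ p)
  even-rotation-upDown [] q _ a _ _ = subst UpDown (sym (++-identityʳ q)) a
  even-rotation-upDown (x₀ ∷ p) [] _ a _ _ = subst UpDown (++-identityʳ (x₀ ∷ p)) a
  even-rotation-upDown (x₀ ∷ p) (y ∷ q) eq a wraps ep with snoc-view y q
  ... | zs , eq-snoc =
    subst UpDown (trans (sym (++-assoc zs [ ℓ ] (x₀ ∷ p))) (cong (_++ x₀ ∷ p) (sym eq-snoc)))
      (alt-join true zs ℓ (x₀ ∷ p) q-upDown ℓ-then-p)
    where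
    ℓ = lastOr y q
    a′ : UpDown ((x₀ ∷ p) ++ zs ++ [ ℓ ])
    a′ = subst (λ l → UpDown ((x₀ ∷ p) ++ l)) eq-snoc a
    zs-odd : Odd zs
    zs-odd = odd-middle (x₀ ∷ p) zs ℓ (subst (λ l → Even ((x₀ ∷ p) ++ l)) eq-snoc eq) ep
    q-upDown : UpDown (zs ++ [ ℓ ])
    q-upDown = subst (λ b → Alt b (zs ++ [ ℓ ])) ep (alt-suffix true (x₀ ∷ p) (zs ++ [ ℓ ]) a′)
    x₀<ℓ : x₀ < ℓ
    x₀<ℓ = subst (x₀ <_) (lastOr-++ x₀ p y q) wraps
    ℓ-then-p : Alt (flips zs true) (ℓ ∷ x₀ ∷ p)
    ℓ-then-p = subst (λ b → Alt b (ℓ ∷ x₀ ∷ p)) (sym zs-odd)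
                 (x₀<ℓ , alt-prefix true (x₀ ∷ p) (zs ++ [ ℓ ]) a′)

  even-rotation-wrapsUp : ∀ x p y q → Even ((x ∷ p) ++ y ∷ q) → Even (x ∷ p) →
    UpDown (y ∷ q ++ x ∷ p) → WrapsUp ((x ∷ p) ++ y ∷ q)
  even-rotation-wrapsUp x p y q eq ep r with snoc-view y q
  ... | zs , eq-snoc = subst (x <_) (sym (lastOr-++ x p y q)) ℓ>x
    where
    ℓ = lastOr y q
    zs-odd : Odd zs
    zs-odd = odd-middle (x ∷ p) zs ℓ (subst (λ l → Even ((x ∷ p) ++ l)) eq-snoc eq) ep
    ℓ>x : x < ℓ
    ℓ>x with subst (λ b → Alt b (ℓ ∷ x ∷ p)) zs-odd
               (alt-suffix true zs (ℓ ∷ x ∷ p)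
                 (subst UpDown (trans (cong (_++ x ∷ p) eq-snoc) (++-assoc zs [ ℓ ] (x ∷ p))) r))
    ... | (x<ℓ , _) = x<ℓ

  maximum-at-odd-position : ∀ p t q → UpDown (p ++ t ∷ q) → All (_≤ t) q → Even (p ++ t ∷ q) → Odd p
  maximum-at-odd-position p t q a q≤t eq with flips p true in ep
  ... | false = refl
  ... | true with subst (λ b → Alt b (t ∷ q)) ep (alt-suffix true p (t ∷ q) a)
  maximum-at-odd-position p t (y ∷ q) a (y≤t ∷ _) eq | true | (t<y , _) = ⊥-elim (≤⇒≯ y≤t t<y)
  maximum-at-odd-position p t [] a [] eq | true | _ with trans (sym eq) (even-++ p [ t ] ep)
  ... | ()

  upDown-extend : ∀ w t → Odd w → UpDown w → All (_< t) w → UpDown (w ++ [ t ])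
  upDown-extend [] t () a w<t
  upDown-extend (y ∷ w) t ow a w<t with snoc-view y w
  ... | zs , e = subst (λ l → UpDown (l ++ [ t ])) (sym e)
                   (extend zs (lastOr y w) (subst Odd e ow) (subst UpDown e a) (subst (All (_< t)) e w<t))
    where
    extend : ∀ zs ℓ → Odd (zs ++ [ ℓ ]) → UpDown (zs ++ [ ℓ ]) → All (_< t) (zs ++ [ ℓ ]) →
      UpDown ((zs ++ [ ℓ ]) ++ [ t ])
    extend zs ℓ ow a w<t = subst UpDown (sym (++-assoc zs [ ℓ ] [ t ]))
      (alt-join true zs ℓ [ t ] a (subst (λ b → Alt b (ℓ ∷ t ∷ [])) (sym zs-even) (ℓ<t , tt)))
      where
      zs-even : Even zs
      zs-even = not-injective (trans (sym (flips-snoc zs ℓ true)) ow)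
      ℓ<t : ℓ < t
      ℓ<t = All.head (All.++⁻ʳ zs w<t)

module EvenPositions {A : Set} where

  open import Data.Nat using (zero; pred)
  open import Data.List using (List; []; _∷_; _++_; length)
  open import Data.List.Membership.Propositional using (_∈_)
  open import Data.List.Relation.Unary.Any using (here; there)
  open import Data.List.Relation.Unary.All as All using (_∷_)
  open import Data.List.Relation.Unary.AllPairs using (_∷_)
  open import Data.List.Relation.Unary.Unique.Propositional using (Unique)
  open import Data.Product using (_×_; _,_; ∃₂)
  open import Relation.Binary.PropositionalEquality using (refl; cong)
  open Alternating using (Even)

  evens : List A → List A
  evens [] = []
  evens (x ∷ []) = x ∷ []
  evens (x ∷ y ∷ t) = x ∷ evens t

  evens-complete : ∀ xs y ys → Even xs → y ∈ evens (xs ++ y ∷ ys)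
  evens-complete [] y [] e = here refl
  evens-complete [] y (z ∷ ys) e = here refl
  evens-complete (x ∷ []) y ys ()
  evens-complete (x ∷ x′ ∷ xs) y ys e = there (evens-complete xs y ys e)

  evens-sound : ∀ {y} a → y ∈ evens a → ∃₂ λ xs ys → a ≡ xs ++ y ∷ ys × Even xs
  evens-sound (x ∷ []) (here refl) = [] , [] , refl , refl
  evens-sound (x ∷ z ∷ t) (here refl) = [] , z ∷ t , refl , refl
  evens-sound (x ∷ z ∷ t) (there y∈) with evens-sound t y∈
  ... | xs , ys , refl , e = x ∷ z ∷ xs , ys , refl , e

  evens-length : ∀ k a → length a ≡ k * 2 → length (evens a) ≡ k
  evens-length zero [] e = refl
  evens-length (suc k) (x ∷ y ∷ t) e = cong suc (evens-length k t (cong (λ n → pred (pred n)) e))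

  evens-⊆ : ∀ {y} a → y ∈ evens a → y ∈ a
  evens-⊆ (x ∷ []) (here e) = here e
  evens-⊆ (x ∷ y ∷ t) (here e) = here e
  evens-⊆ (x ∷ y ∷ t) (there y∈) = there (there (evens-⊆ t y∈))

  evens-unique : ∀ a → Unique a → Unique (evens a)
  evens-unique [] u = u
  evens-unique (x ∷ []) u = u
  evens-unique (x ∷ y ∷ t) (x∉ ∷ (_ ∷ u)) =
    All.tabulate (λ z∈ → All.lookup x∉ (there (evens-⊆ t z∈))) ∷ evens-unique t u

module Cycles (m : ℕ) where

  open import Data.Nat.Properties using (≤-reflexive)
  open import Data.Fin using (Fin)
  open import Data.Fin.Properties using (_≟_)
  open import Data.Vec using (toList; tabulate)
  open import Data.Vec.Properties using (lookup∘tabulate; tabulate∘lookup; tabulate-cong; length-toList)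
  open import Data.Vec.Membership.Propositional.Properties using (∈-lookup; ∈-toList⁺)
  open import Data.List using (List; []; _∷_; _++_; [_]; length; iterate; allFin)
  open import Data.List.Properties using (length-++-comm; length-iterate; length-tabulate)
  open import Data.List.Membership.Propositional using (_∈_)
  open import Data.List.Membership.Propositional.Properties using (∈-∃++; ∈-allFin; ∈-++⁺ˡ; ∈-++⁺ʳ)
  open import Data.List.Relation.Unary.Any using (here; there)
  open import Data.List.Relation.Unary.All as All using (_∷_)
  open import Data.List.Relation.Unary.AllPairs using (_∷_)
  open import Data.List.Relation.Unary.Unique.Propositional using (Unique)
  import Data.List.Relation.Unary.Unique.Propositional.Properties as Unique
  open import Data.List.Relation.Binary.Permutation.Propositional.Properties using (∈-resp-↭; ++-comm)
  open import Data.Product using (_,_)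
  open import Data.Empty using (⊥-elim)
  open import Relation.Binary.PropositionalEquality using (refl; sym; trans; cong; subst)
  open Chains {Fin (suc m)}
  open DuplicateFree {Fin (suc m)}
  open Successor (_≟_ {suc m})

  n : ℕ
  n = suc m

  X : Set
  X = Fin n

  unique⇒complete : ∀ (w : List X) → Unique w → length w ≡ n → ∀ x → x ∈ w
  unique⇒complete w u len x =
    unique-covering _≟_ w (allFin n) u (λ _ → ∈-allFin _)
      (≤-reflexive (trans (length-tabulate (λ i → i)) (sym len))) (∈-allFin x)

  complete⇒unique : ∀ (w : List X) → (∀ x → x ∈ w) → length w ≡ n → Unique w
  complete⇒unique w cov len =
    covering-unique _≟_ w (allFin n) (Unique.allFin⁺ n) (λ _ → cov _)
      (≤-reflexive (trans len (sym (length-tabulate (λ i → i)))))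

  perm-injective : ∀ (σ : Word n) → IsPerm σ → ∀ {i j} → app σ i ≡ app σ j → i ≡ j
  perm-injective σ = lookup-injective
    where
    open import Data.Vec using (Vec; _∷_; lookup)
    open import Data.Fin using (zero; suc)
    lookup-injective : ∀ {k} {v : Vec X k} → Unique (toList v) → ∀ {i j} → lookup v i ≡ lookup v j → i ≡ j
    lookup-injective {v = x ∷ v} u {zero} {zero} e = refl
    lookup-injective {v = x ∷ v} (x∉ ∷ u) {zero} {suc j} e =
      ⊥-elim (All.lookup x∉ (∈-toList⁺ (∈-lookup j v)) e)
    lookup-injective {v = x ∷ v} (x∉ ∷ u) {suc i} {zero} e =
      ⊥-elim (All.lookup x∉ (∈-toList⁺ (∈-lookup i v)) (sym e))
    lookup-injective {v = x ∷ v} (x∉ ∷ u) {suc i} {suc j} e = cong suc (lookup-injective u e)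

  record Traces (σ : Word n) (w : List X) : Set where
    constructor traces
    field
      full     : length w ≡ n
      distinct : Unique w
      closed   : Closed (app σ) w

  traces-complete : ∀ {σ} {w} → Traces σ w → ∀ x → x ∈ w
  traces-complete {w = w} (traces len u _) = unique⇒complete w u len

  traces-cycleFrom : ∀ {σ h r} → Traces σ (h ∷ r) → cycleFrom σ h ≡ h ∷ r
  traces-cycleFrom {σ} {h} {r} (traces len _ c) =
    subst (λ l → iterate (app σ) h l ≡ h ∷ r) len (closed-iterate h r c)

  traces-rotate : ∀ {σ} p q → Traces σ (p ++ q) → Traces σ (q ++ p)
  traces-rotate p q t@(traces len _ c) =
    traces len′ (complete⇒unique (q ++ p) (λ x → ∈-resp-↭ (++-comm p q) (traces-complete t x)) len′)
      (closed-rotate p q c)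
    where
    len′ : length (q ++ p) ≡ n
    len′ = trans (sym (length-++-comm p q)) len

  traces-rotation : ∀ {σ} p z q → Traces σ (p ++ z ∷ q) → cycleFrom σ z ≡ z ∷ q ++ p
  traces-rotation p z q t = traces-cycleFrom (traces-rotate p (z ∷ q) t)

  traces-cyclic : ∀ {σ w} → Traces σ w → IsCyclic σ
  traces-cyclic {σ} {w} t i j with ∈-∃++ (traces-complete t i)
  ... | p , q , refl =
    subst (j ∈_) (sym (traces-rotation p i q t)) (∈-resp-↭ (++-comm p (i ∷ q)) (traces-complete t j))

  -- σ is onto (every point is the image of its predecessor on the cycle), hence a permutation.
  traces-perm : ∀ {σ w} → Traces σ w → IsPerm σ
  traces-perm {σ} {[]} (traces () _ _)
  traces-perm {σ} {h ∷ r} t@(traces _ _ c) = complete⇒unique (toList σ) onto (length-toList σ)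
    where
    later : ∀ {x} → x ∈ h ∷ r → x ∈ r ++ [ h ]
    later (here refl) = ∈-++⁺ʳ r (here refl)
    later (there x∈r) = ∈-++⁺ˡ x∈r
    onto : ∀ x → x ∈ toList σ
    onto x with chain-image h (r ++ [ h ]) c (later (traces-complete t x))
    ... | u , refl = ∈-toList⁺ (∈-lookup u σ)

  cyclic-traces : ∀ σ → IsPerm σ → IsCyclic σ → ∀ i → Traces σ (cycleFrom σ i)
  cyclic-traces σ p cyc i =
    traces len u (orbit-closed (perm-injective σ p) m i u (cyc i))
    where
    len : length (cycleFrom σ i) ≡ n
    len = length-iterate (app σ) i n
    u : Unique (cycleFrom σ i)
    u = complete⇒unique (cycleFrom σ i) (cyc i) len

  cycleOf : List X → Word n
  cycleOf [] = tabulate (λ i → i)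
  cycleOf (h ∷ r) = tabulate (after h (h ∷ r))

  cycleOf-traces : ∀ w → length w ≡ n → Unique w → Traces (cycleOf w) w
  cycleOf-traces [] () u
  cycleOf-traces (h ∷ r) len u =
    traces len u (chain-cong (λ x → sym (lookup∘tabulate (after h (h ∷ r)) x)) _ (after-chain h (h ∷ r) u))

  traces-cycleOf : ∀ {σ w} → Traces σ w → cycleOf w ≡ σ
  traces-cycleOf {σ} {[]} (traces () _ _)
  traces-cycleOf {σ} {h ∷ r} t@(traces _ u c) =
    trans (tabulate-cong (λ x → after-closed (app σ) h r x u c (traces-complete t x))) (tabulate∘lookup σ)

module Arrangements where

  open Counting
  open import Data.Fin using (Fin; toℕ)
  open import Data.List using (List; length; map)
  open import Data.List.Relation.Unary.Unique.Propositional using (Unique)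
  open import Data.Product using (_×_)

  Arrangement : ∀ n → List (Fin n) → Set
  Arrangement n w = length w ≡ n × Unique w × UpDown (map toℕ w)

  arrangements-count : ∀ n → Counts (Arrangement n) (E n)
  arrangements-count n = counts-bij toList toList-inj (λ {v} p → length-toList v , p) from-list
    (Enumeration.counts-words isAlternating?)
    where
    open import Data.Vec using (toList; fromList; cast)
    open import Data.Vec.Properties using (length-toList; toList-injective; toList-cast; toList∘fromList)
    open import Data.Vec.Relation.Binary.Equality.Cast using (cast-is-id)
    open import Data.Product using (∃; _,_)
    open import Relation.Binary.PropositionalEquality using (refl; sym; trans; subst)
    toList-inj : ∀ {v w : Word n} → IsAlternating v → IsAlternating w → toList v ≡ toList w → v ≡ w
    toList-inj {v} {w} _ _ e = trans (sym (cast-is-id refl v)) (toList-injective refl v w e)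
    from-list : ∀ {w} → Arrangement n w → ∃ λ v → IsAlternating v × toList v ≡ w
    from-list {w} (len , u , a) = v , subst (λ l → Unique l × UpDown (map toℕ l)) (sym v≡w) (u , a) , v≡w
      where
      v = cast len (fromList w)
      v≡w : toList v ≡ w
      v≡w = trans (toList-cast len (fromList w)) (toList∘fromList w)

module CyclicCount (m : ℕ) where

  open import Data.Nat using (_<_)
  open import Data.Nat.Properties using (+-comm; suc-injective)
  open import Data.Bool using (true; false; not)
  open import Data.Fin using (Fin; toℕ; zero; fromℕ; inject₁; lower₁)
  open import Data.Fin.Properties
    using ( any?; toℕ<n; toℕ≤pred[n]; toℕ-inject₁; toℕ-fromℕ; fromℕ≢inject₁; inject₁-lower₁
          ; inject₁-injective; toℕ-injective)
  open import Data.List using (List; []; _∷_; _++_; [_]; length; map; filter)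
  open import Data.List.Properties
    using ( map-++; length-map; length-++; ++-assoc; ++-identityʳ; ∷-injectiveˡ; ∷-injectiveʳ
          ; map-injective; map-cong; map-∘)
  open import Data.List.Membership.Propositional using (_∈_; _∉_)
  open import Data.List.Membership.Propositional.Properties using (∈-∃++; ∈-map⁻)
  open import Data.List.Relation.Unary.Any using (here; there)
  open import Data.List.Relation.Unary.All as All using (All; [])
  import Data.List.Relation.Unary.All.Properties as All
  open import Data.List.Relation.Unary.AllPairs using ([]; _∷_)
  open import Data.List.Relation.Unary.Unique.Propositional using (Unique)
  import Data.List.Relation.Unary.Unique.Propositional.Properties as Unique
  open import Data.Product using (_×_; ∃; _,_; proj₁; proj₂)
  open import Data.Empty using (⊥-elim)
  open import Relation.Nullary using (¬_; Dec; ¬?; _×-dec_)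
  open import Relation.Binary.PropositionalEquality
    using (_≢_; refl; sym; trans; cong; cong₂; subst; module ≡-Reasoning)
  open Counting
  open Arrangements
  open Cycles m
  open Alternating
  open DuplicateFree {X} using (unique-notin; unique-remove)

  labels : List X → List ℕ
  labels = map toℕ

  GoodStart : Word n → X → Set
  GoodStart σ i = UpDown (labels (cycleFrom σ i))

  traced-good : ∀ {σ h r} → Traces σ (h ∷ r) → UpDown (labels (h ∷ r)) → IsCyclicGenUpDown σ × GoodStart σ h
  traced-good t a = (traces-perm t , traces-cyclic t , _ , good) , good
    where good = subst (λ l → UpDown (labels l)) (sym (traces-cycleFrom t)) a

  Marked : Word n × X → Set
  Marked p = IsCyclicGenUpDown (proj₁ p) × GoodStart (proj₁ p) (proj₂ p)

  -- Marked pairs correspond to alternating arrangements (the cycle of σ read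
  -- from i), so there are E n of them.
  marked-count : Counts Marked (E n)
  marked-count = counts-bij mark injective preserves onto (arrangements-count n)
    where
    mark : List X → Word n × X
    mark [] = cycleOf [] , zero
    mark (h ∷ r) = cycleOf (h ∷ r) , h
    injective : ∀ {w w′} → Arrangement n w → Arrangement n w′ → mark w ≡ mark w′ → w ≡ w′
    injective {[]} (() , _)
    injective {_} {[]} _ (() , _)
    injective {h ∷ r} {h′ ∷ r′} (len , u , _) (len′ , u′ , _) e with cong proj₂ e
    ... | refl = begin
      h ∷ r                           ≡⟨ sym (traces-cycleFrom (cycleOf-traces (h ∷ r) len u)) ⟩
      cycleFrom (cycleOf (h ∷ r)) h   ≡⟨ cong (λ σ → cycleFrom σ h) (cong proj₁ e) ⟩
      cycleFrom (cycleOf (h ∷ r′)) h  ≡⟨ traces-cycleFrom (cycleOf-traces (h ∷ r′) len′ u′) ⟩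
      h ∷ r′                          ∎
      where open ≡-Reasoning
    preserves : ∀ {w} → Arrangement n w → Marked (mark w)
    preserves {[]} (() , _)
    preserves {h ∷ r} (len , u , a) = traced-good (cycleOf-traces (h ∷ r) len u) a
    onto : ∀ {p} → Marked p → ∃ λ w → Arrangement n w × mark w ≡ p
    onto {σ , i} ((perm , cyc , _) , good) =
      cycleFrom σ i , (Traces.full t , Traces.distinct t , good) , cong (_, i) (traces-cycleOf t)
      where t = cyclic-traces σ perm cyc i

  module EvenLength (k : ℕ) (n≡2k : n ≡ k * 2) where

    Wide : Word n → Set
    Wide σ = ∃ λ i → GoodStart σ i × WrapsUp (labels (cycleFrom σ i))

    labels-++ : ∀ p q → labels (p ++ q) ≡ labels p ++ labels q
    labels-++ = map-++ toℕ

    full-even : ∀ (w : List X) → length w ≡ n → Even (labels w)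
    full-even w len = even-double k (labels w) (trans (length-map toℕ w) (trans len n≡2k))

    rotation-good : ∀ p q → length (p ++ q) ≡ n → UpDown (labels (p ++ q)) → WrapsUp (labels (p ++ q)) →
      Even p → UpDown (labels (q ++ p))
    rotation-good p q len a wraps ep = subst UpDown (sym (labels-++ q p))
      (even-rotation-upDown (labels p) (labels q) (subst Even (labels-++ p q) (full-even (p ++ q) len))
        (subst UpDown (labels-++ p q) a) (subst WrapsUp (labels-++ p q) wraps) (trans (flips-map toℕ p _) ep))

    rotation-not-good : ∀ p y q → UpDown (labels (p ++ y ∷ q)) → Odd p → ¬ UpDown (labels (y ∷ q ++ p))
    rotation-not-good p y q a op r =
      odd-rotation-not-upDown (labels p) (toℕ y) (labels q) (subst UpDown (labels-++ p (y ∷ q)) a)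
        (trans (flips-map toℕ p _) op) (subst UpDown (cong (toℕ y ∷_) (labels-++ q p)) r)

    rotation-wraps : ∀ x p y q → length ((x ∷ p) ++ y ∷ q) ≡ n → Even (x ∷ p) →
      UpDown (labels (y ∷ q ++ x ∷ p)) → WrapsUp (labels ((x ∷ p) ++ y ∷ q))
    rotation-wraps x p y q len ep r = subst WrapsUp (sym (labels-++ (x ∷ p) (y ∷ q)))
      (even-rotation-wrapsUp (toℕ x) (labels p) (toℕ y) (labels q)
        (subst Even (labels-++ (x ∷ p) (y ∷ q)) (full-even ((x ∷ p) ++ y ∷ q) len))
        (trans (flips-map toℕ (x ∷ p) _) ep)
        (subst UpDown (cong (toℕ y ∷_) (labels-++ q (x ∷ p))) r))

    good-starts-even : ∀ {σ} xs y ys → Traces σ (xs ++ y ∷ ys) → UpDown (labels (xs ++ y ∷ ys)) →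
      GoodStart σ y → Even xs
    good-starts-even xs y ys t a good with flips xs true in parity
    ... | true = refl
    ... | false =
      ⊥-elim (rotation-not-good xs y ys a parity (subst (λ l → UpDown (labels l)) (traces-rotation xs y ys t) good))

    wraps-good-starts : ∀ {σ a} → Traces σ a → UpDown (labels a) → WrapsUp (labels a) →
      Counts (GoodStart σ) k
    wraps-good-starts {σ} {a} t a-good wraps =
      counted (evens a) (evens-unique a (Traces.distinct t)) (evens-length k a (trans (Traces.full t) n≡2k))
        even⇒good good⇒even
      where
      open EvenPositions
      even⇒good : ∀ {y} → y ∈ evens a → GoodStart σ y
      even⇒good {y} y∈ with evens-sound a y∈
      ... | xs , ys , refl , ev = subst (λ l → UpDown (labels l)) (sym (traces-rotation xs y ys t))
                                    (rotation-good xs (y ∷ ys) (Traces.full t) a-good wraps ev)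
      good⇒even : ∀ {y} → GoodStart σ y → y ∈ evens a
      good⇒even {y} good with ∈-∃++ (traces-complete t y)
      ... | xs , ys , refl = evens-complete xs y ys (good-starts-even xs y ys t a-good good)

    narrow-good-start : ∀ {σ a} → Traces σ a → UpDown (labels a) → ¬ WrapsUp (labels a) →
      ∀ xs y ys → a ≡ xs ++ y ∷ ys → GoodStart σ y → xs ≡ []
    narrow-good-start t a-good narrow [] y ys e good = refl
    narrow-good-start t a-good narrow (x ∷ xs) y ys refl good =
      ⊥-elim (narrow (rotation-wraps x xs y ys (Traces.full t) (good-starts-even (x ∷ xs) y ys t a-good good)
                        (subst (λ l → UpDown (labels l)) (traces-rotation (x ∷ xs) y ys t) good)))

    wide-starts : ∀ {σ} → IsCyclicGenUpDown σ × Wide σ → Counts (GoodStart σ) k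
    wide-starts {σ} ((perm , cyc , _) , i , good , wraps) =
      wraps-good-starts (cyclic-traces σ perm cyc i) good wraps

    narrow-start : ∀ {σ} → IsCyclicGenUpDown σ × ¬ Wide σ → Counts (GoodStart σ) 1
    narrow-start {σ} ((perm , cyc , i , good) , not-wide) = counts-single i good only-i
      where
      t = cyclic-traces σ perm cyc i
      only-i : ∀ {y} → GoodStart σ y → y ≡ i
      only-i {y} good-y with ∈-∃++ (traces-complete t y)
      ... | xs , ys , e with narrow-good-start t good (λ wraps → not-wide (i , good , wraps)) xs y ys e good-y
      ...   | refl = sym (∷-injectiveˡ e)

    -- Wide permutations correspond to alternating arrangements of Fin m: append
    -- the maximum point `top` and close the list up into a cycle.
    top : X
    top = fromℕ m

    lift : List (Fin m) → List X
    lift w = map inject₁ w ++ [ top ]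

    length-lift : ∀ w → length (lift w) ≡ suc (length w)
    length-lift w = trans (length-++ (map inject₁ w))
      (trans (+-comm (length (map inject₁ w)) 1) (cong suc (length-map inject₁ w)))

    labels-lift : ∀ w → labels (lift w) ≡ map toℕ w ++ [ m ]
    labels-lift w = trans (labels-++ (map inject₁ w) [ top ]) (cong₂ _++_ labels-inject (cong [_] (toℕ-fromℕ m)))
      where
      labels-inject : labels (map inject₁ w) ≡ map toℕ w
      labels-inject = trans (sym (map-∘ w)) (map-cong toℕ-inject₁ w)

    top∉inject : ∀ w → top ∉ map inject₁ w
    top∉inject w top∈ with ∈-map⁻ inject₁ top∈
    ... | x , _ , e = fromℕ≢inject₁ e

    lift-traces : ∀ {w} → Arrangement m w → Traces (cycleOf (lift w)) (lift w)
    lift-traces {w} (len , u , _) = cycleOf-traces (lift w) (trans (length-lift w) (cong suc len))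
      (Unique.++⁺ (Unique.map⁺ inject₁-injective u) ([] ∷ [])
        (λ { (top∈ , here refl) → top∉inject w top∈ }))

    -- m is odd, so an arrangement of Fin m ends on a descent and may be followed by the maximum.
    arrangement-odd : ∀ {w} → Arrangement m w → Odd (map toℕ w)
    arrangement-odd {w} a = odd-middle [] (map toℕ w) m
      (subst Even (labels-lift w) (full-even (lift w) (Traces.full (lift-traces a)))) refl

    lift-good : ∀ {w} → Arrangement m w → UpDown (labels (lift w)) × WrapsUp (labels (lift w))
    lift-good {[]} a with arrangement-odd a
    ... | ()
    lift-good {y ∷ w} a@(_ , _ , w-good) = subst UpDown (sym (labels-lift (y ∷ w))) extended ,
      subst WrapsUp (sym (labels-lift (y ∷ w)))
        (subst (toℕ y <_) (sym (lastOr-++ (toℕ y) (map toℕ w) m [])) (toℕ<n y))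
      where
      extended : UpDown (map toℕ (y ∷ w) ++ [ m ])
      extended = upDown-extend (map toℕ (y ∷ w)) m (arrangement-odd a) w-good
                   (All.map⁺ (All.tabulate (λ {x} _ → toℕ<n x)))

    unlift : ∀ {σ} w → Traces σ (lift w) → UpDown (labels (lift w)) → Arrangement m w
    unlift w t good = suc-injective (trans (sym (length-lift w)) (Traces.full t)) ,
      Unique.map⁻ (subst Unique (++-identityʳ (map inject₁ w))
                     (unique-remove (map inject₁ w) top [] (Traces.distinct t))) ,
      alt-prefix true (map toℕ w) [ m ] (subst UpDown (labels-lift w) good)

    lower : ∀ (c : List X) → top ∉ c → ∃ λ w → map inject₁ w ≡ c
    lower [] _ = [] , refl
    lower (x ∷ c) top∉ = let (w , e) = lower c (λ top∈ → top∉ (there top∈)) in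
      lower₁ x m≢x ∷ w , cong₂ _∷_ (inject₁-lower₁ x m≢x) e
      where
      m≢x : m ≢ toℕ x
      m≢x e = top∉ (here (toℕ-injective (trans (toℕ-fromℕ m) e)))

    -- In a wide cycle, the reading that starts just after the maximum is good, and it ends at `top`.
    wide-ends-at-top : ∀ {σ a} → Traces σ a → UpDown (labels a) → WrapsUp (labels a) →
      ∃ λ c → Traces σ (c ++ [ top ]) × UpDown (labels (c ++ [ top ]))
    wide-ends-at-top {σ} t a-good wraps with ∈-∃++ (traces-complete t top)
    ... | xs , ys , refl =
      ys ++ xs , subst (Traces σ) rot (traces-rotate (xs ++ [ top ]) ys t′) ,
      subst (λ l → UpDown (labels l)) rot
        (rotation-good (xs ++ [ top ]) ys (Traces.full t′) (subst (λ l → UpDown (labels l)) split a-good)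
           (subst (λ l → WrapsUp (labels l)) split wraps) top-even)
      where
      split : xs ++ top ∷ ys ≡ (xs ++ [ top ]) ++ ys
      split = sym (++-assoc xs [ top ] ys)
      rot : ys ++ xs ++ [ top ] ≡ (ys ++ xs) ++ [ top ]
      rot = sym (++-assoc ys xs [ top ])
      t′ : Traces σ ((xs ++ [ top ]) ++ ys)
      t′ = subst (Traces σ) split t
      labels-split : labels (xs ++ top ∷ ys) ≡ labels xs ++ m ∷ labels ys
      labels-split = trans (labels-++ xs (top ∷ ys)) (cong (λ z → labels xs ++ z ∷ labels ys) (toℕ-fromℕ m))
      xs-odd : Odd xs
      xs-odd = trans (sym (flips-map toℕ xs true))
        (maximum-at-odd-position (labels xs) m (labels ys) (subst UpDown labels-split a-good)
          (All.map⁺ (All.tabulate (λ {y} _ → toℕ≤pred[n] y)))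
          (subst Even labels-split (full-even (xs ++ top ∷ ys) (Traces.full t))))
      top-even : Even (xs ++ [ top ])
      top-even = trans (flips-snoc xs top true) (cong not xs-odd)

    wide-count : Counts (λ σ → IsCyclicGenUpDown σ × Wide σ) (E m)
    wide-count = counts-bij (λ w → cycleOf (lift w)) injective preserves onto (arrangements-count m)
      where
      injective : ∀ {w w′} → Arrangement m w → Arrangement m w′ →
        cycleOf (lift w) ≡ cycleOf (lift w′) → w ≡ w′
      injective {w} {w′} a a′ e = map-injective inject₁-injective (∷-injectiveʳ (begin
        top ∷ map inject₁ w                ≡⟨ sym (traces-rotation (map inject₁ w) top [] (lift-traces a)) ⟩
        cycleFrom (cycleOf (lift w)) top   ≡⟨ cong (λ σ → cycleFrom σ top) e ⟩
        cycleFrom (cycleOf (lift w′)) top  ≡⟨ traces-rotation (map inject₁ w′) top [] (lift-traces a′) ⟩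
        top ∷ map inject₁ w′               ∎))
        where open ≡-Reasoning
      preserves : ∀ {w} → Arrangement m w → IsCyclicGenUpDown (cycleOf (lift w)) × Wide (cycleOf (lift w))
      preserves {[]} a with arrangement-odd a
      ... | ()
      preserves {y ∷ w} a with lift-good a
      ... | good , wraps = let (cgud , start) = traced-good (lift-traces a) good in
        cgud , inject₁ y , start , subst (λ l → WrapsUp (labels l)) (sym (traces-cycleFrom (lift-traces a))) wraps
      top∉ : ∀ {σ} c → Traces σ (c ++ [ top ]) → top ∉ c
      top∉ c t top∈ = unique-notin c top [] (Traces.distinct t) (subst (top ∈_) (sym (++-identityʳ c)) top∈)
      onto : ∀ {σ} → IsCyclicGenUpDown σ × Wide σ → ∃ λ w → Arrangement m w × cycleOf (lift w) ≡ σ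
      onto {σ} ((perm , cyc , _) , i , good , wraps) with wide-ends-at-top (cyclic-traces σ perm cyc i) good wraps
      ... | c , t , c-good with lower c (top∉ c t)
      ...   | w , refl = w , unlift w t c-good , traces-cycleOf t

    wide? : ∀ σ → Dec (Wide σ)
    wide? σ = any? (λ i → upDown? (labels (cycleFrom σ i)) ×-dec wrapsUp? (labels (cycleFrom σ i)))

    narrow : ℕ
    narrow = length (filter (λ σ → isCyclicGenUpDown? σ ×-dec ¬? (wide? σ)) (allVecs n n))

    narrow-count : Counts (λ σ → IsCyclicGenUpDown σ × ¬ Wide σ) narrow
    narrow-count = Enumeration.counts-words (λ σ → isCyclicGenUpDown? σ ×-dec ¬? (wide? σ))

    cyclic-split : numCyclicGenUpDown n ≡ E m + narrow
    cyclic-split = counts-unique (Enumeration.counts-words isCyclicGenUpDown?)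
                                 (counts-split wide? wide-count narrow-count)

    -- Counting the marked pairs (σ , i) by σ: k good starts if σ is wide, one otherwise.
    marked-split : E n ≡ E m * k + narrow * 1
    marked-split = counts-unique marked-count
      (counts-split (λ p → wide? (proj₁ p)) (regroup (counts-Σ {Q = GoodStart} wide-starts wide-count))
                                           (regroup (counts-Σ {Q = GoodStart} narrow-start narrow-count)))
      where
      regroup : ∀ {W : Word n → Set} {c} →
        Counts (λ (p : Word n × X) → (IsCyclicGenUpDown (proj₁ p) × W (proj₁ p))
                                     × GoodStart (proj₁ p) (proj₂ p)) c →
        Counts (λ p → Marked p × W (proj₁ p)) c
      regroup = counts-⇔ (λ ((cg , w) , g) → (cg , g) , w) (λ ((cg , g) , w) → (cg , w) , g)

rearrange : ∀ a b c → (a + b) + c * a ≡ a * suc c + b * 1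
rearrange = solve-∀
  where open import Data.Nat.Tactic.RingSolver using (solve-∀)

lemma3p2 : ∀ (k : ℕ) → 1 ≤ k → numCyclicGenUpDown (2 * k) + (k ∸ 1) * E (2 * k ∸ 1) ≡ E (2 * k)
lemma3p2 (suc k′) _ = begin
  numCyclicGenUpDown (2 * suc k′) + k′ * E m  ≡⟨ cong (_+ k′ * E m) cyclic-split ⟩
  (E m + narrow) + k′ * E m                   ≡⟨ rearrange (E m) narrow k′ ⟩
  E m * suc k′ + narrow * 1                   ≡⟨ sym marked-split ⟩
  E (2 * suc k′)                              ∎
  where
  open import Data.Nat.Properties using (*-comm)
  open import Relation.Binary.PropositionalEquality using (cong; sym; module ≡-Reasoning)
  open ≡-Reasoning
  m : ℕ
  m = 2 * suc k′ ∸ 1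
  open CyclicCount m
  open EvenLength (suc k′) (*-comm 2 (suc k′))
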